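{- Let $\mathbf{k}$ be a field, $d\ge 0$ and $n\ge 2(d+1)$ integers. If $H\in\mathbf{B}_{n,d}$, then $\dim_{\mathbf{k}}\tilde H_d(\mathrm{Ind}(H);\mathbf{k})>0$.
   Context: $\mathrm{Ind}(H)$ is the simplicial complex of independent sets of $H$, and $\tilde H_d$ is reduced simplicial homology. $G\cup H$ is disjoint union, $G+H$ is the join (disjoint union plus all edges between the two parts), extended elementwise to sets of graphs; $K_m$ is the complete graph on $m$ vertices ($K_0$ empty). $\mathbf{B}_{n,0}$ ($n\ge2$) is the set of graphs on $n$ vertices of maximum degree $n-1$, and for $d>0$, $n\ge2(d+1)$, $\mathbf{B}_{n,d}=\bigcup_{m=2d}^{n-2}K_{n-m-2}+(K_2\cup\mathbf{B}_{m,d-1})$. -}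

module Defs where

open import Level using (Level; _⊔_) renaming (suc to lsuc)
open import Data.Nat as ℕ using (ℕ; zero; suc; _+_; _∸_; _≤_)
open import Data.Bool using (Bool; true; false; not; if_then_else_)
open import Data.Fin as Fin using (Fin; toℕ; splitAt)
open import Data.Fin.Properties using () renaming (_≟_ to _≟ᶠ_)
open import Data.Vec using (Vec; []; _∷_; lookup; removeAt)
open import Data.Vec.Properties using (≡-dec)
open import Data.List using (List; []; _∷_; map; concatMap; foldr; filter; length)
open import Data.List using () renaming (allFin to allFinL)
open import Data.Sum using (inj₁; inj₂)
open import Data.Product using (Σ; ∃; _×_; _,_)
open import Data.Unit using (⊤)
open import Relation.Nullary using (¬_; does)
open import Relation.Binary.PropositionalEquality using (_≡_)
open import Algebra.Bundles using (CommutativeRing)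
open import Function.Bundles using (_↔_; Inverse)

record Field (c ℓ : Level) : Set (lsuc (c ⊔ ℓ)) where
  field
    commutativeRing : CommutativeRing c ℓ
  open CommutativeRing commutativeRing public
  field
    0≉1     : ¬ (0# ≈ 1#)
    inverse : ∀ x → ¬ (x ≈ 0#) → ∃ λ y → x * y ≈ 1#

Graph : ℕ → Set
Graph n = Fin n → Fin n → Bool

IsSimple : ∀ {n} → Graph n → Set
IsSimple {n} G = (∀ u v → G u v ≡ G v u) × (∀ v → G v v ≡ false)

degree : ∀ {n} → Graph n → Fin n → ℕ
degree {n} G v = length (filter (λ w → Data.Bool._≟_ (G v w) true) (allFinL n))
  where import Data.Bool

maxDegree : ∀ {n} → Graph n → ℕ
maxDegree {n} G = foldr ℕ._⊔_ 0 (map (degree G) (allFinL n))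

K : (m : ℕ) → Graph m
K m u v = not (does (u ≟ᶠ v))

_∪ᴳ_ : ∀ {a b} → Graph a → Graph b → Graph (a + b)
_∪ᴳ_ {a} G H u v with splitAt a u | splitAt a v
... | inj₁ x | inj₁ y = G x y
... | inj₂ x | inj₂ y = H x y
... | inj₁ _ | inj₂ _ = false
... | inj₂ _ | inj₁ _ = false

_+ᴳ_ : ∀ {a b} → Graph a → Graph b → Graph (a + b)
_+ᴳ_ {a} G H u v with splitAt a u | splitAt a v
... | inj₁ x | inj₁ y = G x y
... | inj₂ x | inj₂ y = H x y
... | inj₁ _ | inj₂ _ = true
... | inj₂ _ | inj₁ _ = true

_≅ᴳ_ : ∀ {n N} → Graph n → Graph N → Set
_≅ᴳ_ {n} {N} G H =
  Σ (Fin n ↔ Fin N) λ f → ∀ u v → G u v ≡ H (Inverse.to f u) (Inverse.to f v)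

-- The classes B_{n,d}  (InB d n G  means  G ∈ B_{n,d}, up to isomorphism)

data InB : ℕ → (n : ℕ) → Graph n → Set where
  base : ∀ {n} {G : Graph n} → 2 ≤ n → IsSimple G → maxDegree G ≡ n ∸ 1 → InB 0 n G
  -- B_{n,d+1} ∋ K_{k} + (K_2 ∪ G'),  G' ∈ B_{m,d},  2(d+1) ≤ m ≤ n-2,  k = n-m-2
  step : ∀ {d n} (k m : ℕ) {G' : Graph m} {H : Graph n} →
         2 ℕ.* suc d ≤ m → InB d m G' →
         H ≅ᴳ (K k +ᴳ (K 2 ∪ᴳ G')) → InB (suc d) n H

-- A p-vertex oriented simplex is a strictly increasing vector of p vertices
-- that is an independent set; C_{q} has p = q+1 (p = 0: the empty face,
-- giving the augmentation, hence reduced homology).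

Increasing : ∀ {n p} → Vec (Fin n) p → Set
Increasing []               = ⊤
Increasing (x ∷ [])         = ⊤
Increasing (x ∷ y ∷ rest)   = (x Fin.< y) × Increasing (y ∷ rest)

Independent : ∀ {n p} → Graph n → Vec (Fin n) p → Set
Independent G σ = ∀ i j → G (lookup σ i) (lookup σ j) ≡ false

IsFace : ∀ {n p} → Graph n → Vec (Fin n) p → Set
IsFace G σ = Increasing σ × Independent G σ

allVecs : (n p : ℕ) → List (Vec (Fin n) p)
allVecs n zero    = [] ∷ []
allVecs n (suc p) = concatMap (λ i → map (i ∷_) (allVecs n p)) (allFinL n)

module Homology {c ℓ} (F : Field c ℓ) where
  open Field F hiding (_+_)

  Σᴸ : ∀ {a} {A : Set a} → List A → (A → Carrier) → Carrier
  Σᴸ xs f = foldr (λ x acc → f x +ᶠ acc) 0# xs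
    where open Field F using () renaming (_+_ to _+ᶠ_)

  sgn : ℕ → Carrier
  sgn zero    = 1#
  sgn (suc i) = - sgn i

  -- cochain-style representation of a chain with p-vertex simplices
  Chain : ℕ → ℕ → Set c
  Chain n p = Vec (Fin n) p → Carrier

  IsChain : ∀ {n p} → Graph n → Chain n p → Set ℓ
  IsChain G x = ∀ σ → ¬ IsFace G σ → x σ ≈ 0#

  ∂ : ∀ {n} p → Chain n (suc p) → Chain n p
  ∂ {n} p x τ =
    Σᴸ (allVecs n (suc p)) λ σ →
      Σᴸ (allFinL (suc p)) λ i →
        if does (≡-dec _≟ᶠ_ (removeAt σ i) τ) then sgn (toℕ i) * x σ else 0#

  NonzeroReducedHomology : ∀ {n} → Graph n → ℕ → Set (c ⊔ ℓ)
  NonzeroReducedHomology {n} G q =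
    Σ (Chain n (suc q)) λ z →
      IsChain G z × (∀ τ → ∂ q z τ ≈ 0#) ×
      ¬ (Σ (Chain n (suc (suc q))) λ b → IsChain G b × (∀ τ → ∂ (suc q) b τ ≈ z τ))

-- Every graph in B_{n,d} has an induced matching x₀y₀, …, x_d y_d whose ends x₀, …, x_d
-- dominate it: in the base case take a vertex of degree n-1 and any other vertex, and in
-- K_k + (K₂ ∪ G') add the edge K₂ to a matching of G'.  The independent sets spanned by an
-- induced matching contain the cross-polytope, the join of the zero-spheres {xᵢ, yᵢ}; its
-- fundamental cycle z = (x₀ - y₀) * … * (x_d - y_d) is built by iterated coning, and the Leibniz
-- rule ∂(a * c) = c - a * ∂c makes it a cycle.  The face {x₀, …, x_d} has coefficient ±1 in z,
-- but since the xᵢ dominate it is a maximal independent set, so it lies in the boundary of no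
-- (d+1)-chain: z is not a boundary.

module Submission where

open import Defs
open import Level using (Level)
open import Data.Nat as ℕ using (ℕ; zero; suc; _*_; _≤_; _∸_; s≤s)
open import Data.Nat.Properties using (⊔-sel; m≤n⇒m≤1+n; 1+n≰n; ≮⇒≥)
open import Data.Fin using (Fin; zero; suc; toℕ; punchIn; punchOut; splitAt; _↑ˡ_; _↑ʳ_; _<_)
open import Data.Fin.Patterns using (0F; 1F)
open import Data.Fin.Properties
  using (suc-injective; <-cmp; ≤∧≢⇒<; <-trans; <-irrefl; <-asym; <⇒≢; punchInᵢ≢i; any?;
         splitAt-↑ˡ; splitAt-↑ʳ; splitAt⁻¹-↑ˡ; splitAt⁻¹-↑ʳ; _≟_; _<?_)
open import Data.Vec using (Vec; []; _∷_; lookup; removeAt; insertAt)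
open import Data.Vec.Properties
  using (≡-dec; ∷-injectiveˡ; ∷-injectiveʳ; insertAt-lookup; insertAt-punchIn; removeAt-punchOut)
open import Data.List using (List; []; _∷_; map; concatMap; _++_; foldr; filter; length; tabulate; allFin)
open import Data.List.Properties using (map-tabulate; length-tabulate; filter-notAll; filter-accept; filter-reject)
open import Data.List.Relation.Unary.Any.Properties using (tabulate⁺)
open import Data.Bool using (true; false; if_then_else_)
import Data.Bool as Bool
open import Data.Product using (∃; ∃₂; _×_; _,_; proj₁; proj₂)
open import Data.Sum using (_⊎_; inj₁; inj₂; [_,_]′; map₂)
open import Data.Unit using (tt)
open import Data.Empty using (⊥-elim)
open import Relation.Nullary using (¬_; Dec; yes; no; does)
open import Relation.Nullary.Decidable using (_×-dec_)
open import Relation.Unary using (Pred; Decidable)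
open import Relation.Binary using (tri<; tri≈; tri>)
open import Relation.Binary.PropositionalEquality
  using (_≡_; _≢_; refl; sym; trans; cong; cong₂; subst; module ≡-Reasoning)
open import Function using (_∘_; id)
open import Function.Bundles using (Inverse)

lookup-removeAt⁻ : ∀ {A : Set} {p} (σ : Vec A (suc p)) k j → j ≡ k ⊎ ∃ λ j′ → lookup σ j ≡ lookup (removeAt σ k) j′
lookup-removeAt⁻ σ k j with k ≟ j
... | yes k≡j = inj₁ (sym k≡j)
... | no  k≢j = inj₂ (punchOut k≢j , sym (removeAt-punchOut σ k≢j))

module _ {n : ℕ} where

  infix 4 _∈_

  _∈_ : ∀ {p} → Fin n → Vec (Fin n) p → Set
  u ∈ σ = ∃ λ j → lookup σ j ≡ u

  _∈?_ : ∀ {p} (u : Fin n) (σ : Vec (Fin n) p) → Dec (u ∈ σ)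
  u ∈? σ = any? (λ j → lookup σ j ≟ u)

  ∈-tail : ∀ {p} {u t} {σ : Vec (Fin n) p} → u ∈ σ → u ∈ t ∷ σ
  ∈-tail (j , e) = suc j , e

  increasing? : ∀ {p} (σ : Vec (Fin n) p) → Dec (Increasing σ)
  increasing? []          = yes tt
  increasing? (x ∷ [])    = yes tt
  increasing? (x ∷ y ∷ σ) = (x <? y) ×-dec increasing? (y ∷ σ)

  Increasing-tail : ∀ {p} {t} {σ : Vec (Fin n) p} → Increasing (t ∷ σ) → Increasing σ
  Increasing-tail {σ = []}    _       = tt
  Increasing-tail {σ = _ ∷ _} (_ , i) = i

  Increasing-head< : ∀ {p} {t} {σ : Vec (Fin n) p} → Increasing (t ∷ σ) → ∀ j → t < lookup σ j
  Increasing-head< {σ = _ ∷ _} (t<y , _) zero    = t<y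
  Increasing-head< {σ = _ ∷ _} (t<y , i) (suc j) = <-trans t<y (Increasing-head< i j)

  Increasing-∷ : ∀ {p} {t} {σ : Vec (Fin n) p} → (∀ j → t < lookup σ j) → Increasing σ → Increasing (t ∷ σ)
  Increasing-∷ {σ = []}    _ _ = tt
  Increasing-∷ {σ = _ ∷ _} h i = h zero , i

  Increasing-lookup-< : ∀ {p} {σ : Vec (Fin n) p} → Increasing σ →
                        ∀ {i j : Fin p} → i < j → lookup σ i < lookup σ j
  Increasing-lookup-< {σ = _ ∷ _} inc {zero}  {suc j} _         = Increasing-head< inc j
  Increasing-lookup-< {σ = _ ∷ _} inc {suc i} {suc j} (s≤s i<j) = Increasing-lookup-< (Increasing-tail inc) i<j

  Increasing-lookup-injective : ∀ {p} {σ : Vec (Fin n) p} → Increasing σ →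
                                ∀ {i j} → lookup σ i ≡ lookup σ j → i ≡ j
  Increasing-lookup-injective inc {i} {j} e with <-cmp i j
  ... | tri< lt _ _ = ⊥-elim (<⇒≢ (Increasing-lookup-< inc lt) e)
  ... | tri≈ _ eq _ = eq
  ... | tri> _ _ gt = ⊥-elim (<⇒≢ (Increasing-lookup-< inc gt) (sym e))

  insertAt-Increasing⁻ : ∀ {p} (τ : Vec (Fin n) p) i u → Increasing (insertAt τ i u) → Increasing τ
  insertAt-Increasing⁻ τ       zero    u inc = Increasing-tail inc
  insertAt-Increasing⁻ (t ∷ τ) (suc i) u inc =
    Increasing-∷ (λ j → subst (t <_) (insertAt-punchIn τ i u j) (Increasing-head< inc (punchIn i j)))
                 (insertAt-Increasing⁻ τ i u (Increasing-tail inc))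

  ∈⇒insertAt-¬Increasing : ∀ {p} (τ : Vec (Fin n) p) i {u} → u ∈ τ → ¬ Increasing (insertAt τ i u)
  ∈⇒insertAt-¬Increasing τ i {u} (j , e) inc = punchInᵢ≢i i j (Increasing-lookup-injective inc
    (trans (insertAt-punchIn τ i u j) (trans e (sym (insertAt-lookup τ i u)))))

  insert : ∀ {p} → Fin n → Vec (Fin n) p → Vec (Fin n) (suc p)
  insert u []      = u ∷ []
  insert u (t ∷ τ) with u <? t
  ... | yes _ = u ∷ t ∷ τ
  ... | no  _ = t ∷ insert u τ

  -- the position at which  insert u τ  places u
  rank : ∀ {p} → Fin n → Vec (Fin n) p → ℕ
  rank u []      = 0
  rank u (t ∷ τ) with u <? t
  ... | yes _ = 0
  ... | no  _ = suc (rank u τ)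

  insert-< : ∀ {p} {u t} (τ : Vec (Fin n) p) → u < t → insert u (t ∷ τ) ≡ u ∷ t ∷ τ
  insert-< {u = u} {t} τ lt with u <? t
  ... | yes _   = refl
  ... | no  nlt = ⊥-elim (nlt lt)

  insert-≮ : ∀ {p} {u t} (τ : Vec (Fin n) p) → ¬ u < t → insert u (t ∷ τ) ≡ t ∷ insert u τ
  insert-≮ {u = u} {t} τ nlt with u <? t
  ... | yes lt = ⊥-elim (nlt lt)
  ... | no  _  = refl

  rank-< : ∀ {p} {u t} (τ : Vec (Fin n) p) → u < t → rank u (t ∷ τ) ≡ 0
  rank-< {u = u} {t} τ lt with u <? t
  ... | yes _   = refl
  ... | no  nlt = ⊥-elim (nlt lt)

  rank-≮ : ∀ {p} {u t} (τ : Vec (Fin n) p) → ¬ u < t → rank u (t ∷ τ) ≡ suc (rank u τ)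
  rank-≮ {u = u} {t} τ nlt with u <? t
  ... | yes lt = ⊥-elim (nlt lt)
  ... | no  _  = refl

  ∈-insert : ∀ {p} u (ρ : Vec (Fin n) p) → u ∈ insert u ρ
  ∈-insert u []      = zero , refl
  ∈-insert u (t ∷ ρ) with u <? t
  ... | yes _ = zero , refl
  ... | no  _ = ∈-tail (∈-insert u ρ)

  ∈-insert⁺ : ∀ {p} u (ρ : Vec (Fin n) p) {v} → v ∈ ρ → v ∈ insert u ρ
  ∈-insert⁺ u (t ∷ ρ) (j , e) with u <? t
  ∈-insert⁺ u (t ∷ ρ) (j     , e) | yes _ = suc j , e
  ∈-insert⁺ u (t ∷ ρ) (zero  , e) | no  _ = zero , e
  ∈-insert⁺ u (t ∷ ρ) (suc j , e) | no  _ = ∈-tail (∈-insert⁺ u ρ (j , e))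

  ∈-insert⁻ : ∀ {p} u (ρ : Vec (Fin n) p) {v} → v ∈ insert u ρ → v ≡ u ⊎ v ∈ ρ
  ∈-insert⁻ u []      (zero , e) = inj₁ (sym e)
  ∈-insert⁻ u (t ∷ ρ) (j , e) with u <? t
  ∈-insert⁻ u (t ∷ ρ) (zero  , e) | yes _ = inj₁ (sym e)
  ∈-insert⁻ u (t ∷ ρ) (suc j , e) | yes _ = inj₂ (j , e)
  ∈-insert⁻ u (t ∷ ρ) (zero  , e) | no  _ = inj₂ (zero , e)
  ∈-insert⁻ u (t ∷ ρ) (suc j , e) | no  _ = map₂ ∈-tail (∈-insert⁻ u ρ (j , e))

  insert-Increasing : ∀ {p} u (ρ : Vec (Fin n) p) → Increasing ρ → ¬ u ∈ ρ → Increasing (insert u ρ)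
  insert-Increasing u []      _   _ = tt
  insert-Increasing u (t ∷ ρ) inc u∉ with u <? t
  ... | yes lt  = lt , inc
  ... | no  nlt = Increasing-∷ t<insert (insert-Increasing u ρ (Increasing-tail inc) (u∉ ∘ ∈-tail))
    where
    t<insert : ∀ j → t < lookup (insert u ρ) j
    t<insert j with ∈-insert⁻ u ρ (j , refl)
    ... | inj₁ e       = subst (t <_) (sym e) (≤∧≢⇒< (≮⇒≥ nlt) (λ t≡u → u∉ (zero , t≡u)))
    ... | inj₂ (k , e) = subst (t <_) e (Increasing-head< inc k)

  insert-comm : ∀ {p} {u a} (ρ : Vec (Fin n) p) → u ≢ a → insert u (insert a ρ) ≡ insert a (insert u ρ)
  insert-comm {u = u} {a} [] u≢a with <-cmp u a
  ... | tri< u<a _ _ = trans (insert-< [] u<a) (sym (insert-≮ [] (<-asym u<a)))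
  ... | tri≈ _ u≡a _ = ⊥-elim (u≢a u≡a)
  ... | tri> _ _ a<u = trans (insert-≮ [] (<-asym a<u)) (sym (insert-< [] a<u))
  insert-comm {u = u} {a} (t ∷ ρ) u≢a = cases (a <? t) (u <? t)
    where
    open ≡-Reasoning
    cases : Dec (a < t) → Dec (u < t) → insert u (insert a (t ∷ ρ)) ≡ insert a (insert u (t ∷ ρ))
    cases (yes a<t) (yes u<t) with <-cmp u a
    ... | tri< u<a _ _ = begin
      insert u (insert a (t ∷ ρ))   ≡⟨ cong (insert u) (insert-< ρ a<t) ⟩
      insert u (a ∷ t ∷ ρ)          ≡⟨ insert-< (t ∷ ρ) u<a ⟩
      u ∷ a ∷ t ∷ ρ                 ≡⟨ cong (u ∷_) (insert-< ρ a<t) ⟨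
      u ∷ insert a (t ∷ ρ)          ≡⟨ insert-≮ (t ∷ ρ) (<-asym u<a) ⟨
      insert a (u ∷ t ∷ ρ)          ≡⟨ cong (insert a) (insert-< ρ u<t) ⟨
      insert a (insert u (t ∷ ρ))   ∎
    ... | tri≈ _ u≡a _ = ⊥-elim (u≢a u≡a)
    ... | tri> _ _ a<u = begin
      insert u (insert a (t ∷ ρ))   ≡⟨ cong (insert u) (insert-< ρ a<t) ⟩
      insert u (a ∷ t ∷ ρ)          ≡⟨ insert-≮ (t ∷ ρ) (<-asym a<u) ⟩
      a ∷ insert u (t ∷ ρ)          ≡⟨ cong (a ∷_) (insert-< ρ u<t) ⟩
      a ∷ u ∷ t ∷ ρ                 ≡⟨ insert-< (t ∷ ρ) a<u ⟨
      insert a (u ∷ t ∷ ρ)          ≡⟨ cong (insert a) (insert-< ρ u<t) ⟨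
      insert a (insert u (t ∷ ρ))   ∎
    cases (yes a<t) (no u≮t) = begin
      insert u (insert a (t ∷ ρ))   ≡⟨ cong (insert u) (insert-< ρ a<t) ⟩
      insert u (a ∷ t ∷ ρ)          ≡⟨ insert-≮ (t ∷ ρ) (λ u<a → u≮t (<-trans u<a a<t)) ⟩
      a ∷ insert u (t ∷ ρ)          ≡⟨ cong (a ∷_) (insert-≮ ρ u≮t) ⟩
      a ∷ t ∷ insert u ρ            ≡⟨ insert-< (insert u ρ) a<t ⟨
      insert a (t ∷ insert u ρ)     ≡⟨ cong (insert a) (insert-≮ ρ u≮t) ⟨
      insert a (insert u (t ∷ ρ))   ∎
    cases (no a≮t) (yes u<t) = begin
      insert u (insert a (t ∷ ρ))   ≡⟨ cong (insert u) (insert-≮ ρ a≮t) ⟩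
      insert u (t ∷ insert a ρ)     ≡⟨ insert-< (insert a ρ) u<t ⟩
      u ∷ t ∷ insert a ρ            ≡⟨ cong (u ∷_) (insert-≮ ρ a≮t) ⟨
      u ∷ insert a (t ∷ ρ)          ≡⟨ insert-≮ (t ∷ ρ) (λ a<u → a≮t (<-trans a<u u<t)) ⟨
      insert a (u ∷ t ∷ ρ)          ≡⟨ cong (insert a) (insert-< ρ u<t) ⟨
      insert a (insert u (t ∷ ρ))   ∎
    cases (no a≮t) (no u≮t) = begin
      insert u (insert a (t ∷ ρ))   ≡⟨ cong (insert u) (insert-≮ ρ a≮t) ⟩
      insert u (t ∷ insert a ρ)     ≡⟨ insert-≮ (insert a ρ) u≮t ⟩
      t ∷ insert u (insert a ρ)     ≡⟨ cong (t ∷_) (insert-comm ρ u≢a) ⟩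
      t ∷ insert a (insert u ρ)     ≡⟨ insert-≮ (insert u ρ) a≮t ⟨
      insert a (t ∷ insert u ρ)     ≡⟨ cong (insert a) (insert-≮ ρ u≮t) ⟨
      insert a (insert u (t ∷ ρ))   ∎

  rank-insert-< : ∀ {p} {u a} (ρ : Vec (Fin n) p) → u < a → rank u (insert a ρ) ≡ rank u ρ
  rank-insert-< {u = u} {a} []      u<a = rank-< [] u<a
  rank-insert-< {u = u} {a} (t ∷ ρ) u<a = cases (a <? t) (u <? t)
    where
    open ≡-Reasoning
    cases : Dec (a < t) → Dec (u < t) → rank u (insert a (t ∷ ρ)) ≡ rank u (t ∷ ρ)
    cases (yes a<t) _ = begin
      rank u (insert a (t ∷ ρ))   ≡⟨ cong (rank u) (insert-< ρ a<t) ⟩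
      rank u (a ∷ t ∷ ρ)          ≡⟨ rank-< (t ∷ ρ) u<a ⟩
      0                           ≡⟨ rank-< ρ (<-trans u<a a<t) ⟨
      rank u (t ∷ ρ)              ∎
    cases (no a≮t) (yes u<t) = begin
      rank u (insert a (t ∷ ρ))   ≡⟨ cong (rank u) (insert-≮ ρ a≮t) ⟩
      rank u (t ∷ insert a ρ)     ≡⟨ rank-< (insert a ρ) u<t ⟩
      0                           ≡⟨ rank-< ρ u<t ⟨
      rank u (t ∷ ρ)              ∎
    cases (no a≮t) (no u≮t) = begin
      rank u (insert a (t ∷ ρ))   ≡⟨ cong (rank u) (insert-≮ ρ a≮t) ⟩
      rank u (t ∷ insert a ρ)     ≡⟨ rank-≮ (insert a ρ) u≮t ⟩
      suc (rank u (insert a ρ))   ≡⟨ cong suc (rank-insert-< ρ u<a) ⟩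
      suc (rank u ρ)              ≡⟨ rank-≮ ρ u≮t ⟨
      rank u (t ∷ ρ)              ∎

  rank-insert-> : ∀ {p} {u a} (ρ : Vec (Fin n) p) → a < u → rank u (insert a ρ) ≡ suc (rank u ρ)
  rank-insert-> {u = u} {a} []      a<u = rank-≮ [] (<-asym a<u)
  rank-insert-> {u = u} {a} (t ∷ ρ) a<u = cases (a <? t) (u <? t)
    where
    open ≡-Reasoning
    cases : Dec (a < t) → Dec (u < t) → rank u (insert a (t ∷ ρ)) ≡ suc (rank u (t ∷ ρ))
    cases (yes a<t) _ = begin
      rank u (insert a (t ∷ ρ))   ≡⟨ cong (rank u) (insert-< ρ a<t) ⟩
      rank u (a ∷ t ∷ ρ)          ≡⟨ rank-≮ (t ∷ ρ) (<-asym a<u) ⟩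
      suc (rank u (t ∷ ρ))        ∎
    cases (no a≮t) (yes u<t) = ⊥-elim (a≮t (<-trans a<u u<t))
    cases (no a≮t) (no u≮t) = begin
      rank u (insert a (t ∷ ρ))   ≡⟨ cong (rank u) (insert-≮ ρ a≮t) ⟩
      rank u (t ∷ insert a ρ)     ≡⟨ rank-≮ (insert a ρ) u≮t ⟩
      suc (rank u (insert a ρ))   ≡⟨ cong suc (rank-insert-> ρ a<u) ⟩
      suc (suc (rank u ρ))        ≡⟨ cong suc (rank-≮ ρ u≮t) ⟨
      suc (rank u (t ∷ ρ))        ∎

  Increasing-∈⇒insert : ∀ {p} {a} (τ : Vec (Fin n) (suc p)) → Increasing τ → a ∈ τ →
                        ∃ λ ρ → Increasing ρ × ¬ a ∈ ρ × τ ≡ insert a ρ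
  Increasing-∈⇒insert (t ∷ τ) inc (zero , refl) =
    τ , Increasing-tail inc , (λ (j , e) → <-irrefl (sym e) (Increasing-head< inc j)) , insert-head τ inc
    where
    insert-head : ∀ {p} (τ : Vec (Fin n) p) → Increasing (t ∷ τ) → t ∷ τ ≡ insert t τ
    insert-head []      _   = refl
    insert-head (_ ∷ τ) inc = sym (insert-< τ (proj₁ inc))
  Increasing-∈⇒insert {p = suc p} {a} (t ∷ τ) inc (suc j , e)
    with Increasing-∈⇒insert τ (Increasing-tail inc) (j , e)
  ... | ρ , incρ , a∉ρ , refl =
    t ∷ ρ , Increasing-∷ t<ρ incρ , a∉t∷ρ , sym (insert-≮ ρ (<-asym t<a))
    where
    t<a : t < a
    t<a = subst (t <_) e (Increasing-head< inc j)
    t<ρ : ∀ k → t < lookup ρ k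
    t<ρ k = let (k′ , e′) = ∈-insert⁺ a ρ (k , refl) in subst (t <_) e′ (Increasing-head< inc k′)
    a∉t∷ρ : ¬ a ∈ t ∷ ρ
    a∉t∷ρ (zero  , e′) = <-irrefl e′ t<a
    a∉t∷ρ (suc k , e′) = a∉ρ (k , e′)

-- Dominating induced matchings of the graphs in B_{n,d}

record InducedMatching {n d} (G : Graph n) (end : Fin d → Fin 2 → Fin n) : Set where
  field
    edge  : ∀ i → G (end i 0F) (end i 1F) ≡ true
    apart : ∀ {i j} → i ≢ j → ∀ s t → G (end i s) (end j t) ≡ false

Dominates : ∀ {n d} → Graph n → (Fin d → Fin n) → Set
Dominates G x = ∀ u → (∃ λ j → u ≡ x j) ⊎ (∃ λ j → G (x j) u ≡ true)

record DominatingInducedMatching {n} (G : Graph n) (d : ℕ) : Set where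
  field
    end        : Fin d → Fin 2 → Fin n
    matching   : InducedMatching G end
    dominating : Dominates G (λ i → end i 0F)

module _ {a p} {A : Set a} {P : Pred A p} (P? : Decidable P) where

  filter-tabulate-rejected : ∀ {n} (g : Fin n → A) i → ¬ P (g i) → 1 ℕ.+ length (filter P? (tabulate g)) ≤ n
  filter-tabulate-rejected g i ¬Pi =
    subst (1 ℕ.+ length (filter P? (tabulate g)) ≤_) (length-tabulate g) (filter-notAll P? (tabulate g) (tabulate⁺ i ¬Pi))

  filter-tabulate-two-rejected : ∀ {n} (g : Fin n → A) {i j} → i ≢ j → ¬ P (g i) → ¬ P (g j) →
                                 2 ℕ.+ length (filter P? (tabulate g)) ≤ n
  filter-tabulate-two-rejected g {zero} {zero} i≢j _ _ = ⊥-elim (i≢j refl)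
  filter-tabulate-two-rejected g {zero} {suc j} _ ¬Pi ¬Pj
    rewrite filter-reject P? {xs = tabulate (g ∘ suc)} ¬Pi = s≤s (filter-tabulate-rejected (g ∘ suc) j ¬Pj)
  filter-tabulate-two-rejected g {suc i} {zero} _ ¬Pi ¬Pj
    rewrite filter-reject P? {xs = tabulate (g ∘ suc)} ¬Pj = s≤s (filter-tabulate-rejected (g ∘ suc) i ¬Pi)
  filter-tabulate-two-rejected {suc n} g {suc i} {suc j} i≢j ¬Pi ¬Pj = cases (P? (g zero))
    where
    rest : 2 ℕ.+ length (filter P? (tabulate (g ∘ suc))) ≤ n
    rest = filter-tabulate-two-rejected (g ∘ suc) (i≢j ∘ cong suc) ¬Pi ¬Pj
    cases : Dec (P (g zero)) → 2 ℕ.+ length (filter P? (tabulate g)) ≤ suc n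
    cases (yes P0) rewrite filter-accept P? {xs = tabulate (g ∘ suc)} P0 = s≤s rest
    cases (no ¬P0) rewrite filter-reject P? {xs = tabulate (g ∘ suc)} ¬P0 = m≤n⇒m≤1+n rest

foldr-⊔-attained : ∀ {A : Set} (f : A → ℕ) (xs : List A) →
                   foldr ℕ._⊔_ 0 (map f xs) ≡ 0 ⊎ ∃ λ x → f x ≡ foldr ℕ._⊔_ 0 (map f xs)
foldr-⊔-attained f []       = inj₁ refl
foldr-⊔-attained f (x ∷ xs) with ⊔-sel (f x) (foldr ℕ._⊔_ 0 (map f xs))
... | inj₁ e = inj₂ (x , sym e)
... | inj₂ e with foldr-⊔-attained f xs
...   | inj₁ e₀      = inj₁ (trans e e₀)
...   | inj₂ (y , e′) = inj₂ (y , trans e′ (sym e))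

maxDegree⇒universalVertex : ∀ {n} (G : Graph n) → 2 ≤ n → (∀ v → G v v ≡ false) →
                            maxDegree G ≡ n ∸ 1 → ∃ λ v → ∀ u → u ≢ v → G v u ≡ true
maxDegree⇒universalVertex {suc zero} G (s≤s ()) _ _
maxDegree⇒universalVertex {suc (suc n)} G _ loopless maxDeg
  with foldr-⊔-attained (degree G) (allFin (suc (suc n)))
... | inj₁ maxDeg≡0 with () ← trans (sym maxDeg) maxDeg≡0
maxDegree⇒universalVertex {suc (suc n)} G _ loopless maxDeg | inj₂ (v , deg≡max) = v , adjacent
  where
  adjacent : ∀ u → u ≢ v → G v u ≡ true
  adjacent u u≢v with G v u in e
  ... | true  = refl
  ... | false = ⊥-elim (1+n≰n (subst (λ k → 2 ℕ.+ k ≤ suc (suc n)) (trans deg≡max maxDeg)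
    (filter-tabulate-two-rejected (λ w → G v w Bool.≟ true) id (u≢v ∘ sym)
      (λ Gvv → false≢true (trans (sym (loopless v)) Gvv)) (λ Gvu → false≢true (trans (sym e) Gvu)))))
    where
    false≢true : false ≢ true
    false≢true ()

universalVertex⇒DominatingInducedMatching : ∀ {n} (G : Graph n) → 2 ≤ n →
  ∀ v → (∀ u → u ≢ v → G v u ≡ true) → DominatingInducedMatching G 1
universalVertex⇒DominatingInducedMatching {suc zero} G (s≤s ()) _ _
universalVertex⇒DominatingInducedMatching {suc (suc n)} G _ v adjacent = record
  { end        = λ _ → λ { 0F → v ; 1F → w }
  ; matching   = record { edge = λ _ → adjacent w w≢v ; apart = λ { {0F} {0F} ne → ⊥-elim (ne refl) } }
  ; dominating = dominating
  }
  where
  another : Fin (suc (suc n)) → Fin (suc (suc n))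
  another zero    = 1F
  another (suc _) = 0F
  another-≢ : ∀ x → another x ≢ x
  another-≢ zero    ()
  another-≢ (suc _) ()
  w = another v
  w≢v = another-≢ v
  dominating : Dominates G (λ _ → v)
  dominating u with u ≟ v
  ... | yes u≡v = inj₁ (0F , u≡v)
  ... | no  u≢v = inj₂ (0F , adjacent u u≢v)

module _ {n N} {H : Graph n} {B : Graph N} (iso : H ≅ᴳ B) where

  private
    open Inverse (proj₁ iso) using (to; from; strictlyInverseˡ; strictlyInverseʳ)

    ≅-adjacentˡ : ∀ p u → H (from p) u ≡ B p (to u)
    ≅-adjacentˡ p u = trans (proj₂ iso (from p) u) (cong (λ q → B q (to u)) (strictlyInverseˡ p))

    ≅-adjacent : ∀ p q → H (from p) (from q) ≡ B p q
    ≅-adjacent p q = trans (≅-adjacentˡ p (from q)) (cong (B p) (strictlyInverseˡ q))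

  DominatingInducedMatching-≅ : ∀ {d} → DominatingInducedMatching B d → DominatingInducedMatching H d
  DominatingInducedMatching-≅ M = record
    { end        = λ i s → from (end i s)
    ; matching   = record
      { edge  = λ i → trans (≅-adjacent _ _) (edge i)
      ; apart = λ i≢j s t → trans (≅-adjacent _ _) (apart i≢j s t)
      }
    ; dominating = dominatingH
    }
    where
    open DominatingInducedMatching M
    open InducedMatching matching
    dominatingH : Dominates H (λ i → from (end i 0F))
    dominatingH u with dominating (to u)
    ... | inj₁ (j , e)   = inj₁ (j , trans (sym (strictlyInverseʳ u)) (cong from e))
    ... | inj₂ (j , adj) = inj₂ (j , trans (≅-adjacentˡ _ u) adj)

data SplitView (a b : ℕ) : Fin (a ℕ.+ b) → Set where
  left  : ∀ i → SplitView a b (i ↑ˡ b)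
  right : ∀ r → SplitView a b (a ↑ʳ r)

splitView : ∀ a b (u : Fin (a ℕ.+ b)) → SplitView a b u
splitView a b u with splitAt a u in e
... | inj₁ i = subst (SplitView a b) (splitAt⁻¹-↑ˡ e) (left i)
... | inj₂ r = subst (SplitView a b) (splitAt⁻¹-↑ʳ e) (right r)

module _ {a b} (G : Graph a) (H : Graph b) where

  +ᴳ-↑ʳ : ∀ r s → (G +ᴳ H) (a ↑ʳ r) (a ↑ʳ s) ≡ H r s
  +ᴳ-↑ʳ r s rewrite splitAt-↑ʳ a b r | splitAt-↑ʳ a b s = refl

  +ᴳ-↑ʳ-↑ˡ : ∀ r i → (G +ᴳ H) (a ↑ʳ r) (i ↑ˡ b) ≡ true
  +ᴳ-↑ʳ-↑ˡ r i rewrite splitAt-↑ʳ a b r | splitAt-↑ˡ a i b = refl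

  ∪ᴳ-↑ˡ : ∀ i j → (G ∪ᴳ H) (i ↑ˡ b) (j ↑ˡ b) ≡ G i j
  ∪ᴳ-↑ˡ i j rewrite splitAt-↑ˡ a i b | splitAt-↑ˡ a j b = refl

  ∪ᴳ-↑ʳ : ∀ r s → (G ∪ᴳ H) (a ↑ʳ r) (a ↑ʳ s) ≡ H r s
  ∪ᴳ-↑ʳ r s rewrite splitAt-↑ʳ a b r | splitAt-↑ʳ a b s = refl

  ∪ᴳ-↑ˡ-↑ʳ : ∀ i r → (G ∪ᴳ H) (i ↑ˡ b) (a ↑ʳ r) ≡ false
  ∪ᴳ-↑ˡ-↑ʳ i r rewrite splitAt-↑ˡ a i b | splitAt-↑ʳ a b r = refl

  ∪ᴳ-↑ʳ-↑ˡ : ∀ r i → (G ∪ᴳ H) (a ↑ʳ r) (i ↑ˡ b) ≡ false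
  ∪ᴳ-↑ʳ-↑ˡ r i rewrite splitAt-↑ʳ a b r | splitAt-↑ˡ a i b = refl

-- The new matching edge is the K₂; the universal vertices of K_k are dominated by its first end.
DominatingInducedMatching-join : ∀ {d} k {m} (G : Graph m) → DominatingInducedMatching G d →
                                 DominatingInducedMatching (K k +ᴳ (K 2 ∪ᴳ G)) (suc d)
DominatingInducedMatching-join {d} k {m} G M = record
  { end        = end⁺
  ; matching   = record { edge = edge⁺ ; apart = apart⁺ }
  ; dominating = dominating⁺
  }
  where
  open DominatingInducedMatching M
  open InducedMatching matching
  B = K k +ᴳ (K 2 ∪ᴳ G)

  end⁺ : Fin (suc d) → Fin 2 → Fin (k ℕ.+ (2 ℕ.+ m))
  end⁺ zero    s = k ↑ʳ (s ↑ˡ m)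
  end⁺ (suc i) s = k ↑ʳ (2 ↑ʳ end i s)

  inner : ∀ r s → B (k ↑ʳ r) (k ↑ʳ s) ≡ (K 2 ∪ᴳ G) r s
  inner = +ᴳ-↑ʳ (K k) (K 2 ∪ᴳ G)

  edge⁺ : ∀ i → B (end⁺ i 0F) (end⁺ i 1F) ≡ true
  edge⁺ zero    = trans (inner _ _) (∪ᴳ-↑ˡ (K 2) G 0F 1F)
  edge⁺ (suc i) = trans (inner _ _) (trans (∪ᴳ-↑ʳ (K 2) G _ _) (edge i))

  apart⁺ : ∀ {i j} → i ≢ j → ∀ s t → B (end⁺ i s) (end⁺ j t) ≡ false
  apart⁺ {zero}  {zero}  i≢j _ _ = ⊥-elim (i≢j refl)
  apart⁺ {zero}  {suc j} _   s t = trans (inner _ _) (∪ᴳ-↑ˡ-↑ʳ (K 2) G s _)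
  apart⁺ {suc i} {zero}  _   s t = trans (inner _ _) (∪ᴳ-↑ʳ-↑ˡ (K 2) G _ t)
  apart⁺ {suc i} {suc j} i≢j s t =
    trans (inner _ _) (trans (∪ᴳ-↑ʳ (K 2) G _ _) (apart (i≢j ∘ cong suc) s t))

  dominating⁺ : Dominates B (λ i → end⁺ i 0F)
  dominating⁺ u with splitView k (2 ℕ.+ m) u
  ... | left i = inj₂ (0F , +ᴳ-↑ʳ-↑ˡ (K k) (K 2 ∪ᴳ G) _ i)
  ... | right r with splitView 2 m r
  ...   | left 0F = inj₁ (0F , refl)
  ...   | left 1F = inj₂ (0F , trans (inner _ _) (∪ᴳ-↑ˡ (K 2) G 0F 1F))
  ...   | right v with dominating v
  ...     | inj₁ (j , refl) = inj₁ (suc j , refl)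
  ...     | inj₂ (j , adj)  = inj₂ (suc j , trans (inner _ _) (trans (∪ᴳ-↑ʳ (K 2) G _ _) adj))

InB⇒DominatingInducedMatching : ∀ {d n} {G : Graph n} → InB d n G → DominatingInducedMatching G (suc d)
InB⇒DominatingInducedMatching {G = G} (base 2≤n (_ , loopless) maxDeg) =
  let (v , adjacent) = maxDegree⇒universalVertex G 2≤n loopless maxDeg
  in universalVertex⇒DominatingInducedMatching G 2≤n v adjacent
InB⇒DominatingInducedMatching (step k _ {G′} _ G′∈B iso) =
  DominatingInducedMatching-≅ iso (DominatingInducedMatching-join k G′ (InB⇒DominatingInducedMatching G′∈B))

module Chains {c ℓ : Level} (F : Field c ℓ) where

  open Field F hiding (zero; refl; sym; trans) renaming (_*_ to _·_)
  open Field F using () renaming (refl to ≈-refl; sym to ≈-sym; trans to ≈-trans)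
  open Homology F using (Σᴸ; sgn; Chain; IsChain; ∂; NonzeroReducedHomology)
  open import Algebra.Properties.Ring ring using (-‿distribˡ-*; -‿distribʳ-*; -1*x≈-x; x[y-z]≈xy-xz)
  open import Algebra.Properties.AbelianGroup +-abelianGroup using (⁻¹-∙-comm; ⁻¹-involutive; ε⁻¹≈ε)
  open import Algebra.Properties.CommutativeSemigroup +-commutativeSemigroup using (interchange)
  open import Relation.Binary.Reasoning.Setoid setoid

  x-0#≈x : ∀ x → x - 0# ≈ x
  x-0#≈x x = ≈-trans (+-congˡ ε⁻¹≈ε) (+-identityʳ x)

  0#-0#≈0# : 0# - 0# ≈ 0#
  0#-0#≈0# = x-0#≈x 0#

  -x·y≈-[x·y] : ∀ x y → (- x) · y ≈ - (x · y)
  -x·y≈-[x·y] x y = ≈-sym (-‿distribˡ-* x y)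

  when : ∀ {a} {A : Set a} → Dec A → Carrier → Carrier
  when d x = if does d then x else 0#

  when-yes : ∀ {a} {A : Set a} (d : Dec A) {x} → A → when d x ≡ x
  when-yes (yes _) _ = refl
  when-yes (no ¬a) a = ⊥-elim (¬a a)

  when-no : ∀ {a} {A : Set a} (d : Dec A) {x} → ¬ A → when d x ≡ 0#
  when-no (yes a) ¬a = ⊥-elim (¬a a)
  when-no (no _)  _  = refl

  when-≈0# : ∀ {a} {A : Set a} (d : Dec A) {x} → (A → x ≈ 0#) → when d x ≈ 0#
  when-≈0# (yes a) h = h a
  when-≈0# (no _)  _ = ≈-refl

  module _ {a} {A : Set a} where

    Σᴸ-cong : ∀ xs {f g : A → Carrier} → (∀ x → f x ≈ g x) → Σᴸ xs f ≈ Σᴸ xs g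
    Σᴸ-cong []       h = ≈-refl
    Σᴸ-cong (x ∷ xs) h = +-cong (h x) (Σᴸ-cong xs h)

    Σᴸ-zero : ∀ xs {f : A → Carrier} → (∀ x → f x ≈ 0#) → Σᴸ xs f ≈ 0#
    Σᴸ-zero []       h = ≈-refl
    Σᴸ-zero (x ∷ xs) h = ≈-trans (+-cong (h x) (Σᴸ-zero xs h)) (+-identityˡ 0#)

    Σᴸ-+ : ∀ xs (f g : A → Carrier) → Σᴸ xs (λ x → f x + g x) ≈ Σᴸ xs f + Σᴸ xs g
    Σᴸ-+ []       f g = ≈-sym (+-identityˡ 0#)
    Σᴸ-+ (x ∷ xs) f g = ≈-trans (+-congˡ (Σᴸ-+ xs f g)) (interchange _ _ _ _)

    Σᴸ-*ˡ : ∀ xs a (f : A → Carrier) → a · Σᴸ xs f ≈ Σᴸ xs (λ x → a · f x)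
    Σᴸ-*ˡ []       a f = zeroʳ a
    Σᴸ-*ˡ (x ∷ xs) a f = ≈-trans (distribˡ a _ _) (+-congˡ (Σᴸ-*ˡ xs a f))

    Σᴸ-neg : ∀ xs (f : A → Carrier) → - Σᴸ xs f ≈ Σᴸ xs (λ x → - f x)
    Σᴸ-neg []       f = ε⁻¹≈ε
    Σᴸ-neg (x ∷ xs) f = ≈-trans (≈-sym (⁻¹-∙-comm _ _)) (+-congˡ (Σᴸ-neg xs f))

    Σᴸ-sub : ∀ xs (f g : A → Carrier) → Σᴸ xs (λ x → f x - g x) ≈ Σᴸ xs f - Σᴸ xs g
    Σᴸ-sub xs f g = ≈-trans (Σᴸ-+ xs f (λ x → - g x)) (+-congˡ (≈-sym (Σᴸ-neg xs g)))

    Σᴸ-++ : ∀ xs ys (f : A → Carrier) → Σᴸ (xs ++ ys) f ≈ Σᴸ xs f + Σᴸ ys f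
    Σᴸ-++ []       ys f = ≈-sym (+-identityˡ _)
    Σᴸ-++ (x ∷ xs) ys f = ≈-trans (+-congˡ (Σᴸ-++ xs ys f)) (≈-sym (+-assoc _ _ _))

  module _ {a b} {A : Set a} {B : Set b} where

    Σᴸ-map : ∀ (g : A → B) xs (f : B → Carrier) → Σᴸ (map g xs) f ≡ Σᴸ xs (f ∘ g)
    Σᴸ-map g []       f = refl
    Σᴸ-map g (x ∷ xs) f = cong (f (g x) +_) (Σᴸ-map g xs f)

    Σᴸ-concatMap : ∀ (g : A → List B) xs (f : B → Carrier) →
                   Σᴸ (concatMap g xs) f ≈ Σᴸ xs (λ x → Σᴸ (g x) f)
    Σᴸ-concatMap g []       f = ≈-refl
    Σᴸ-concatMap g (x ∷ xs) f = ≈-trans (Σᴸ-++ (g x) _ f) (+-congˡ (Σᴸ-concatMap g xs f))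

    Σᴸ-comm : ∀ xs ys (f : A → B → Carrier) →
              Σᴸ xs (λ x → Σᴸ ys (f x)) ≈ Σᴸ ys (λ y → Σᴸ xs (λ x → f x y))
    Σᴸ-comm []       ys f = ≈-sym (Σᴸ-zero ys (λ _ → ≈-refl))
    Σᴸ-comm (x ∷ xs) ys f = ≈-trans (+-congˡ (Σᴸ-comm xs ys f)) (≈-sym (Σᴸ-+ ys (f x) _))

  Σᶠ : ∀ n → (Fin n → Carrier) → Carrier
  Σᶠ n = Σᴸ (allFin n)

  Σᵛ : ∀ n p → (Vec (Fin n) p → Carrier) → Carrier
  Σᵛ n p = Σᴸ (allVecs n p)

  Σᶠ-suc : ∀ n (f : Fin (suc n) → Carrier) → Σᶠ (suc n) f ≡ f zero + Σᶠ n (f ∘ suc)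
  Σᶠ-suc n f = cong (f zero +_)
    (trans (cong (λ xs → Σᴸ xs f) (sym (map-tabulate id suc))) (Σᴸ-map suc (allFin n) f))

  Σᶠ-cong : ∀ n {f g : Fin n → Carrier} → (∀ x → f x ≈ g x) → Σᶠ n f ≈ Σᶠ n g
  Σᶠ-cong n = Σᴸ-cong (allFin n)

  Σᶠ-δ : ∀ n (t : Fin n) (f : Fin n → Carrier) → (∀ j → j ≢ t → f j ≈ 0#) → Σᶠ n f ≈ f t
  Σᶠ-δ (suc n) zero f h = begin
    Σᶠ (suc n) f             ≡⟨ Σᶠ-suc n f ⟩
    f zero + Σᶠ n (f ∘ suc)  ≈⟨ +-congˡ (Σᴸ-zero (allFin n) (λ j → h (suc j) (λ ()))) ⟩
    f zero + 0#              ≈⟨ +-identityʳ _ ⟩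
    f zero                   ∎
  Σᶠ-δ (suc n) (suc t) f h = begin
    Σᶠ (suc n) f             ≡⟨ Σᶠ-suc n f ⟩
    f zero + Σᶠ n (f ∘ suc)  ≈⟨ +-cong (h zero (λ ())) (Σᶠ-δ n t (f ∘ suc) (λ j j≢t → h (suc j) (j≢t ∘ suc-injective))) ⟩
    0# + f (suc t)           ≈⟨ +-identityˡ _ ⟩
    f (suc t)                ∎

  Σᵛ-suc : ∀ n p (f : Vec (Fin n) (suc p) → Carrier) → Σᵛ n (suc p) f ≈ Σᶠ n (λ j → Σᵛ n p (f ∘ (j ∷_)))
  Σᵛ-suc n p f = ≈-trans (Σᴸ-concatMap (λ i → map (i ∷_) (allVecs n p)) (allFin n) f)
    (Σᶠ-cong n (λ j → reflexive (Σᴸ-map (j ∷_) (allVecs n p) f)))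

  Σᵛ-δ : ∀ n p (τ : Vec (Fin n) p) (f : Vec (Fin n) p → Carrier) → (∀ σ → σ ≢ τ → f σ ≈ 0#) → Σᵛ n p f ≈ f τ
  Σᵛ-δ n zero    []      f h = +-identityʳ _
  Σᵛ-δ n (suc p) (t ∷ τ) f h = begin
    Σᵛ n (suc p) f                       ≈⟨ Σᵛ-suc n p f ⟩
    Σᶠ n (λ j → Σᵛ n p (f ∘ (j ∷_)))     ≈⟨ Σᶠ-δ n t _ (λ j j≢t → Σᴸ-zero (allVecs n p) (λ σ → h (j ∷ σ) (j≢t ∘ ∷-injectiveˡ))) ⟩
    Σᵛ n p (f ∘ (t ∷_))                  ≈⟨ Σᵛ-δ n p τ (f ∘ (t ∷_)) (λ σ σ≢τ → h (t ∷ σ) (σ≢τ ∘ ∷-injectiveʳ)) ⟩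
    f (t ∷ τ)                            ∎

  module _ {n : ℕ} where

    _≟ᵛ_ : ∀ {p} (σ τ : Vec (Fin n) p) → Dec (σ ≡ τ)
    _≟ᵛ_ = ≡-dec _≟_

    when-≡-∷ : ∀ {p} t (ρ τ : Vec (Fin n) p) x →
               when ((t ∷ ρ) ≟ᵛ (t ∷ τ)) x ≡ when (ρ ≟ᵛ τ) x
    when-≡-∷ t ρ τ x = cases (ρ ≟ᵛ τ)
      where
      cases : Dec (ρ ≡ τ) → when ((t ∷ ρ) ≟ᵛ (t ∷ τ)) x ≡ when (ρ ≟ᵛ τ) x
      cases (yes ρ≡τ) = trans (when-yes ((t ∷ ρ) ≟ᵛ (t ∷ τ)) (cong (t ∷_) ρ≡τ)) (sym (when-yes (ρ ≟ᵛ τ) ρ≡τ))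
      cases (no  ρ≢τ) = trans (when-no ((t ∷ ρ) ≟ᵛ (t ∷ τ)) (ρ≢τ ∘ ∷-injectiveʳ)) (sym (when-no (ρ ≟ᵛ τ) ρ≢τ))

    Σᵛ-removeAt : ∀ p i (τ : Vec (Fin n) p) (g : Vec (Fin n) (suc p) → Carrier) →
                  Σᵛ n (suc p) (λ σ → when (removeAt σ i ≟ᵛ τ) (g σ)) ≈ Σᶠ n (λ u → g (insertAt τ i u))
    Σᵛ-removeAt p zero τ g = ≈-trans (Σᵛ-suc n p _) (Σᶠ-cong n (λ j →
      ≈-trans (Σᵛ-δ n p τ _ (λ σ σ≢τ → reflexive (when-no (σ ≟ᵛ τ) σ≢τ)))
            (reflexive (when-yes (τ ≟ᵛ τ) refl))))
    Σᵛ-removeAt (suc p) (suc i) (t ∷ τ) g = begin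
      Σᵛ n (suc (suc p)) (λ σ → when (removeAt σ (suc i) ≟ᵛ (t ∷ τ)) (g σ))
        ≈⟨ Σᵛ-suc n (suc p) _ ⟩
      Σᶠ n (λ j → Σᵛ n (suc p) (λ σ → when (removeAt (j ∷ σ) (suc i) ≟ᵛ (t ∷ τ)) (g (j ∷ σ))))
        ≈⟨ Σᶠ-δ n t _ (λ j j≢t → Σᴸ-zero (allVecs n (suc p)) (λ σ → reflexive
             (when-no (removeAt (j ∷ σ) (suc i) ≟ᵛ (t ∷ τ)) (j≢t ∘ ∷-injectiveˡ ∘ trans (sym (removeAt-suc j σ)))))) ⟩
      Σᵛ n (suc p) (λ σ → when (removeAt (t ∷ σ) (suc i) ≟ᵛ (t ∷ τ)) (g (t ∷ σ)))
        ≈⟨ Σᴸ-cong (allVecs n (suc p)) (λ σ → reflexive (trans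
             (cong (λ ρ → when (ρ ≟ᵛ (t ∷ τ)) (g (t ∷ σ))) (removeAt-suc t σ))
             (when-≡-∷ t (removeAt σ i) τ (g (t ∷ σ))))) ⟩
      Σᵛ n (suc p) (λ σ → when (removeAt σ i ≟ᵛ τ) (g (t ∷ σ)))
        ≈⟨ Σᵛ-removeAt p i τ (g ∘ (t ∷_)) ⟩
      Σᶠ n (λ u → g (t ∷ insertAt τ i u)) ∎
      where
      removeAt-suc : ∀ j (σ : Vec (Fin n) (suc p)) → removeAt (j ∷ σ) (suc i) ≡ j ∷ removeAt σ i
      removeAt-suc j (_ ∷ _) = refl

    -- the coefficient of τ in ∂ x contributed by the faces τ + u
    insertionSum : ∀ {p} → Chain n (suc p) → Vec (Fin n) p → Fin n → Carrier
    insertionSum {p} x τ u = Σᶠ (suc p) (λ i → sgn (toℕ i) · x (insertAt τ i u))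

    ∂≈Σ-insertionSum : ∀ p (x : Chain n (suc p)) τ → ∂ p x τ ≈ Σᶠ n (insertionSum x τ)
    ∂≈Σ-insertionSum p x τ = begin
      ∂ p x τ
        ≈⟨ Σᴸ-comm (allVecs n (suc p)) (allFin (suc p)) _ ⟩
      Σᶠ (suc p) (λ i → Σᵛ n (suc p) (λ σ → when (removeAt σ i ≟ᵛ τ) (sgn (toℕ i) · x σ)))
        ≈⟨ Σᶠ-cong (suc p) (λ i → Σᵛ-removeAt p i τ (λ σ → sgn (toℕ i) · x σ)) ⟩
      Σᶠ (suc p) (λ i → Σᶠ n (λ u → sgn (toℕ i) · x (insertAt τ i u)))
        ≈⟨ Σᴸ-comm (allFin (suc p)) (allFin n) _ ⟩
      Σᶠ n (insertionSum x τ) ∎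

    ∂-sub : ∀ p (x y : Chain n (suc p)) τ → ∂ p (λ σ → x σ - y σ) τ ≈ ∂ p x τ - ∂ p y τ
    ∂-sub p x y τ = begin
      ∂ p (λ σ → x σ - y σ) τ
        ≈⟨ ∂≈Σ-insertionSum p _ τ ⟩
      Σᶠ n (λ u → Σᶠ (suc p) (λ i → sgn (toℕ i) · (x (insertAt τ i u) - y (insertAt τ i u))))
        ≈⟨ Σᶠ-cong n (λ u → ≈-trans (Σᶠ-cong (suc p) (λ i → x[y-z]≈xy-xz _ _ _)) (Σᴸ-sub (allFin (suc p)) _ _)) ⟩
      Σᶠ n (λ u → insertionSum x τ u - insertionSum y τ u)
        ≈⟨ Σᴸ-sub (allFin n) _ _ ⟩
      Σᶠ n (insertionSum x τ) - Σᶠ n (insertionSum y τ)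
        ≈⟨ +-cong (∂≈Σ-insertionSum p x τ) (-‿cong (∂≈Σ-insertionSum p y τ)) ⟨
      ∂ p x τ - ∂ p y τ ∎

  sgn²≈1# : ∀ k → sgn k · sgn k ≈ 1#
  sgn²≈1# zero    = *-identityˡ 1#
  sgn²≈1# (suc k) = begin
    (- sgn k) · (- sgn k)  ≈⟨ -x·y≈-[x·y] _ _ ⟩
    - (sgn k · - sgn k)    ≈⟨ -‿cong (-‿distribʳ-* _ _) ⟨
    - (- (sgn k · sgn k))  ≈⟨ ⁻¹-involutive _ ⟩
    sgn k · sgn k          ≈⟨ sgn²≈1# k ⟩
    1#                     ∎

  sgn·sgn·x≈x : ∀ k x → sgn k · (sgn k · x) ≈ x
  sgn·sgn·x≈x k x = ≈-trans (≈-sym (*-assoc _ _ _)) (≈-trans (*-congʳ (sgn²≈1# k)) (*-identityˡ x))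

  IsSign : Carrier → Set ℓ
  IsSign z = z ≈ 1# ⊎ z ≈ - 1#

  IsSign-sgn : ∀ k → IsSign (sgn k)
  IsSign-sgn zero    = inj₁ ≈-refl
  IsSign-sgn (suc k) with IsSign-sgn k
  ... | inj₁ e = inj₂ (-‿cong e)
  ... | inj₂ e = inj₁ (≈-trans (-‿cong e) (⁻¹-involutive 1#))

  IsSign-· : ∀ {a b} → IsSign a → IsSign b → IsSign (a · b)
  IsSign-· (inj₁ ea) (inj₁ eb) = inj₁ (≈-trans (*-cong ea eb) (*-identityˡ 1#))
  IsSign-· (inj₁ ea) (inj₂ eb) = inj₂ (≈-trans (*-cong ea eb) (*-identityˡ _))
  IsSign-· (inj₂ ea) (inj₁ eb) = inj₂ (≈-trans (*-cong ea eb) (*-identityʳ _))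
  IsSign-· (inj₂ ea) (inj₂ eb) = inj₁ (≈-trans (*-cong ea eb) (≈-trans (-1*x≈-x _) (⁻¹-involutive 1#)))

  IsSign-resp-≈ : ∀ {a b} → a ≈ b → IsSign a → IsSign b
  IsSign-resp-≈ a≈b (inj₁ e) = inj₁ (≈-trans (≈-sym a≈b) e)
  IsSign-resp-≈ a≈b (inj₂ e) = inj₂ (≈-trans (≈-sym a≈b) e)

  IsSign⇒≉0# : ∀ {z} → IsSign z → ¬ z ≈ 0#
  IsSign⇒≉0# (inj₁ e) z≈0 = 0≉1 (≈-trans (≈-sym z≈0) e)
  IsSign⇒≉0# (inj₂ e) z≈0 = 0≉1 (≈-sym (begin
    1#         ≈⟨ ⁻¹-involutive 1# ⟨
    - (- 1#)   ≈⟨ -‿cong e ⟨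
    - _        ≈⟨ -‿cong z≈0 ⟩
    - 0#       ≈⟨ ε⁻¹≈ε ⟩
    0#         ∎))

  module _ {n : ℕ} where

    SupportedOnIncreasing : ∀ {p} → Chain n p → Set ℓ
    SupportedOnIncreasing x = ∀ σ → ¬ Increasing σ → x σ ≈ 0#

    insertionSum-∈ : ∀ {p} (x : Chain n (suc p)) τ {u} → SupportedOnIncreasing x → u ∈ τ →
                     insertionSum x τ u ≈ 0#
    insertionSum-∈ x τ x-inc u∈τ = Σᴸ-zero (allFin _) (λ i →
      ≈-trans (*-congˡ (x-inc _ (∈⇒insertAt-¬Increasing τ i u∈τ))) (zeroʳ _))

    -- only the sorted insertion survives, with the sign of the position it lands in
    insertionSum-∉ : ∀ {p} (x : Chain n (suc p)) τ u → SupportedOnIncreasing x → Increasing τ → ¬ u ∈ τ →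
                     insertionSum x τ u ≈ sgn (rank u τ) · x (insert u τ)
    insertionSum-∉ x [] u _ _ _ = +-identityʳ _
    insertionSum-∉ {suc p} x (t ∷ τ) u x-inc inc u∉ with u <? t
    ... | yes u<t = begin
      insertionSum x (t ∷ τ) u
        ≡⟨ Σᶠ-suc (suc p) _ ⟩
      1# · x (u ∷ t ∷ τ) + Σᶠ (suc p) (λ i → (- sgn (toℕ i)) · x (t ∷ insertAt τ i u))
        ≈⟨ +-congˡ (Σᴸ-zero (allFin (suc p)) (λ i → ≈-trans (*-congˡ (x-inc _ (t∷τ+u-¬Increasing i))) (zeroʳ _))) ⟩
      1# · x (u ∷ t ∷ τ) + 0#
        ≈⟨ +-identityʳ _ ⟩
      1# · x (u ∷ t ∷ τ) ∎
      where
      t∷τ+u-¬Increasing : ∀ i → ¬ Increasing (t ∷ insertAt τ i u)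
      t∷τ+u-¬Increasing i inc′ = <-asym u<t (subst (t <_) (insertAt-lookup τ i u) (Increasing-head< inc′ i))
    ... | no u≮t = begin
      insertionSum x (t ∷ τ) u
        ≡⟨ Σᶠ-suc (suc p) _ ⟩
      1# · x (u ∷ t ∷ τ) + Σᶠ (suc p) (λ i → (- sgn (toℕ i)) · x (t ∷ insertAt τ i u))
        ≈⟨ +-cong (≈-trans (*-congˡ (x-inc _ (u≮t ∘ proj₁))) (zeroʳ _)) (Σᶠ-cong (suc p) (λ i → -x·y≈-[x·y] _ _)) ⟩
      0# + Σᶠ (suc p) (λ i → - (sgn (toℕ i) · x (t ∷ insertAt τ i u)))
        ≈⟨ +-identityˡ _ ⟩
      Σᶠ (suc p) (λ i → - (sgn (toℕ i) · x (t ∷ insertAt τ i u)))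
        ≈⟨ Σᴸ-neg (allFin (suc p)) _ ⟨
      - insertionSum (x ∘ (t ∷_)) τ u
        ≈⟨ -‿cong (insertionSum-∉ (x ∘ (t ∷_)) τ u (λ σ ¬inc → x-inc (t ∷ σ) (¬inc ∘ Increasing-tail))
                                   (Increasing-tail inc) (u∉ ∘ ∈-tail)) ⟩
      - (sgn (rank u τ) · x (t ∷ insert u τ))
        ≈⟨ -x·y≈-[x·y] _ _ ⟨
      (- sgn (rank u τ)) · x (t ∷ insert u τ) ∎

    ∂-vanishes-at-maximalFace : ∀ (G : Graph n) {p} (b : Chain n (suc p)) σ → IsChain G b →
                                (∀ i u → ¬ IsFace G (insertAt σ i u)) → ∂ p b σ ≈ 0#
    ∂-vanishes-at-maximalFace G {p} b σ b-chain maximal = ≈-trans (∂≈Σ-insertionSum p b σ)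
      (Σᴸ-zero (allFin n) (λ u → Σᴸ-zero (allFin (suc p)) (λ i →
        ≈-trans (*-congˡ (b-chain _ (maximal i u))) (zeroʳ _))))

  -- Coning off a chain from an apex vertex

  module _ {n : ℕ} where

    -- cone′ a c ρ = Σₖ (-1)ᵏ [ρₖ = a] c (removeAt ρ k)
    cone′ : ∀ {p} → Fin n → Chain n p → Chain n (suc p)
    cone′ {zero}  a c (v ∷ []) = when (v ≟ a) (c [])
    cone′ {suc p} a c (v ∷ σ)  = when (v ≟ a) (c σ) - cone′ a (c ∘ (v ∷_)) σ

    cone : ∀ {p} → Fin n → Chain n p → Chain n (suc p)
    cone a c σ = when (increasing? σ) (cone′ a c σ)

    ApexFree : ∀ {p} → Fin n → Chain n p → Set ℓ
    ApexFree a c = ∀ σ → ¬ Increasing σ ⊎ a ∈ σ → c σ ≈ 0#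

    cone-SupportedOnIncreasing : ∀ {p} a (c : Chain n p) → SupportedOnIncreasing (cone a c)
    cone-SupportedOnIncreasing a c σ ¬inc = reflexive (when-no (increasing? σ) ¬inc)

    cone-Increasing : ∀ {p} a (c : Chain n p) {σ} → Increasing σ → cone a c σ ≈ cone′ a c σ
    cone-Increasing a c {σ} inc = reflexive (when-yes (increasing? σ) inc)

    cone′-vanishes : ∀ {p} a (c : Chain n p) σ → (∀ k → lookup σ k ≡ a → c (removeAt σ k) ≈ 0#) →
                     cone′ a c σ ≈ 0#
    cone′-vanishes {zero}  a c (v ∷ []) h = when-≈0# (v ≟ a) (h zero)
    cone′-vanishes {suc p} a c (v ∷ σ)  h = ≈-trans
      (+-cong (when-≈0# (v ≟ a) (h zero))
              (-‿cong (cone′-vanishes a (c ∘ (v ∷_)) σ (λ k e → ≈-trans (reflexive (cong c (removeAt-suc σ k))) (h (suc k) e)))))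
      0#-0#≈0#
      where
      removeAt-suc : ∀ (σ : Vec (Fin n) (suc p)) k → v ∷ removeAt σ k ≡ removeAt (v ∷ σ) (suc k)
      removeAt-suc (_ ∷ _) k = refl

    cone-vanishes : ∀ {p} a (c : Chain n p) σ → (∀ k → lookup σ k ≡ a → c (removeAt σ k) ≈ 0#) →
                    cone a c σ ≈ 0#
    cone-vanishes a c σ h with increasing? σ
    ... | yes _ = cone′-vanishes a c σ h
    ... | no  _ = ≈-refl

    cone-∉ : ∀ {p} a (c : Chain n p) σ → ¬ a ∈ σ → cone a c σ ≈ 0#
    cone-∉ a c σ a∉σ = cone-vanishes a c σ (λ k e → ⊥-elim (a∉σ (k , e)))

    cone-zero : ∀ {p} a (c : Chain n p) σ → (∀ ρ → c ρ ≈ 0#) → cone a c σ ≈ 0#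
    cone-zero a c σ c≈0 = cone-vanishes a c σ (λ k _ → c≈0 _)

    cone′-insert : ∀ {p} a (c : Chain n p) τ → ¬ a ∈ τ → cone′ a c (insert a τ) ≈ sgn (rank a τ) · c τ
    cone′-insert a c [] _ = ≈-trans (reflexive (when-yes (a ≟ a) refl)) (≈-sym (*-identityˡ _))
    cone′-insert a c (t ∷ τ) a∉ with a <? t
    ... | yes _ = begin
      when (a ≟ a) (c (t ∷ τ)) - cone′ a (c ∘ (a ∷_)) (t ∷ τ)
        ≈⟨ +-cong (reflexive (when-yes (a ≟ a) refl)) (-‿cong (cone′-vanishes a _ (t ∷ τ) (λ k e → ⊥-elim (a∉ (k , e))))) ⟩
      c (t ∷ τ) - 0#
        ≈⟨ x-0#≈x _ ⟩
      c (t ∷ τ)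
        ≈⟨ *-identityˡ _ ⟨
      1# · c (t ∷ τ) ∎
    ... | no _ = begin
      when (t ≟ a) (c (insert a τ)) - cone′ a (c ∘ (t ∷_)) (insert a τ)
        ≈⟨ +-cong (reflexive (when-no (t ≟ a) (λ t≡a → a∉ (zero , t≡a)))) (-‿cong (cone′-insert a _ τ (a∉ ∘ ∈-tail))) ⟩
      0# - (sgn (rank a τ) · c (t ∷ τ))
        ≈⟨ +-identityˡ _ ⟩
      - (sgn (rank a τ) · c (t ∷ τ))
        ≈⟨ -x·y≈-[x·y] _ _ ⟨
      (- sgn (rank a τ)) · c (t ∷ τ) ∎

    cone-insert : ∀ {p} a (c : Chain n p) τ → Increasing τ → ¬ a ∈ τ →
                  cone a c (insert a τ) ≈ sgn (rank a τ) · c τ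
    cone-insert a c τ inc a∉ = ≈-trans (cone-Increasing a c (insert-Increasing a τ inc a∉)) (cone′-insert a c τ a∉)

    ∂-cone-∉ : ∀ {p} a (c : Chain n p) τ → Increasing τ → ¬ a ∈ τ → ∂ p (cone a c) τ ≈ c τ
    ∂-cone-∉ {p} a c τ inc a∉τ = begin
      ∂ p (cone a c) τ                     ≈⟨ ∂≈Σ-insertionSum p (cone a c) τ ⟩
      Σᶠ n (insertionSum (cone a c) τ)     ≈⟨ Σᶠ-cong n term ⟩
      Σᶠ n (λ u → when (u ≟ a) (c τ))      ≈⟨ Σᶠ-δ n a _ (λ u u≢a → reflexive (when-no (u ≟ a) u≢a)) ⟩
      when (a ≟ a) (c τ)                   ≈⟨ reflexive (when-yes (a ≟ a) refl) ⟩
      c τ                                  ∎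
      where
      term : ∀ u → insertionSum (cone a c) τ u ≈ when (u ≟ a) (c τ)
      term u with u ∈? τ
      ... | yes u∈τ = ≈-trans (insertionSum-∈ (cone a c) τ (cone-SupportedOnIncreasing a c) u∈τ)
                            (reflexive (sym (when-no (u ≟ a) (λ u≡a → a∉τ (subst (_∈ τ) u≡a u∈τ)))))
      ... | no u∉τ with u ≟ a
      ...   | yes refl = begin
        insertionSum (cone a c) τ a            ≈⟨ insertionSum-∉ (cone a c) τ a (cone-SupportedOnIncreasing a c) inc u∉τ ⟩
        sgn (rank a τ) · cone a c (insert a τ) ≈⟨ *-congˡ (cone-insert a c τ inc a∉τ) ⟩
        sgn (rank a τ) · (sgn (rank a τ) · c τ) ≈⟨ sgn·sgn·x≈x (rank a τ) (c τ) ⟩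
        c τ                                    ∎
      ...   | no u≢a = begin
        insertionSum (cone a c) τ u            ≈⟨ insertionSum-∉ (cone a c) τ u (cone-SupportedOnIncreasing a c) inc u∉τ ⟩
        sgn (rank u τ) · cone a c (insert u τ) ≈⟨ *-congˡ (cone-∉ a c _ a∉insert) ⟩
        sgn (rank u τ) · 0#                    ≈⟨ zeroʳ _ ⟩
        0#                                     ∎
        where
        a∉insert : ¬ a ∈ insert u τ
        a∉insert a∈ = [ (λ a≡u → u≢a (sym a≡u)) , a∉τ ]′ (∈-insert⁻ u τ a∈)

    -- inserting two distinct vertices in either order: exactly one of them passes the other
    rank-insert-sign : ∀ {p} u a (ρ : Vec (Fin n) p) → u ≢ a →
      sgn (rank u (insert a ρ)) · sgn (rank a (insert u ρ)) ≈ - (sgn (rank a ρ) · sgn (rank u ρ))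
    rank-insert-sign u a ρ u≢a with <-cmp u a
    ... | tri< u<a _ _ rewrite rank-insert-< ρ u<a | rank-insert-> ρ u<a =
      ≈-trans (≈-sym (-‿distribʳ-* _ _)) (-‿cong (*-comm _ _))
    ... | tri≈ _ u≡a _ = ⊥-elim (u≢a u≡a)
    ... | tri> _ _ a<u rewrite rank-insert-> ρ a<u | rank-insert-< ρ a<u =
      ≈-trans (-x·y≈-[x·y] _ _) (-‿cong (*-comm _ _))

    insertionSum-cone-insert : ∀ {q} a (c : Chain n (suc q)) ρ u → SupportedOnIncreasing c →
      Increasing ρ → ¬ a ∈ ρ → ¬ u ∈ insert a ρ →
      insertionSum (cone a c) (insert a ρ) u ≈ - (sgn (rank a ρ) · insertionSum c ρ u)
    insertionSum-cone-insert a c ρ u c-inc inc a∉ρ u∉ = begin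
      insertionSum (cone a c) (insert a ρ) u
        ≈⟨ insertionSum-∉ (cone a c) (insert a ρ) u (cone-SupportedOnIncreasing a c) (insert-Increasing a ρ inc a∉ρ) u∉ ⟩
      sgn (rank u (insert a ρ)) · cone a c (insert u (insert a ρ))
        ≈⟨ *-congˡ (reflexive (cong (cone a c) (insert-comm ρ u≢a))) ⟩
      sgn (rank u (insert a ρ)) · cone a c (insert a (insert u ρ))
        ≈⟨ *-congˡ (cone-insert a c (insert u ρ) (insert-Increasing u ρ inc u∉ρ) a∉) ⟩
      sgn (rank u (insert a ρ)) · (sgn (rank a (insert u ρ)) · c (insert u ρ))
        ≈⟨ *-assoc _ _ _ ⟨
      (sgn (rank u (insert a ρ)) · sgn (rank a (insert u ρ))) · c (insert u ρ)
        ≈⟨ *-congʳ (rank-insert-sign u a ρ u≢a) ⟩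
      (- (sgn (rank a ρ) · sgn (rank u ρ))) · c (insert u ρ)
        ≈⟨ -x·y≈-[x·y] _ _ ⟩
      - ((sgn (rank a ρ) · sgn (rank u ρ)) · c (insert u ρ))
        ≈⟨ -‿cong (*-assoc _ _ _) ⟩
      - (sgn (rank a ρ) · (sgn (rank u ρ) · c (insert u ρ)))
        ≈⟨ -‿cong (*-congˡ (insertionSum-∉ c ρ u c-inc inc u∉ρ)) ⟨
      - (sgn (rank a ρ) · insertionSum c ρ u) ∎
      where
      u≢a : u ≢ a
      u≢a u≡a = u∉ (subst (_∈ insert a ρ) (sym u≡a) (∈-insert a ρ))
      u∉ρ : ¬ u ∈ ρ
      u∉ρ = u∉ ∘ ∈-insert⁺ a ρ
      a∉ : ¬ a ∈ insert u ρ
      a∉ a∈ = [ (λ a≡u → u≢a (sym a≡u)) , a∉ρ ]′ (∈-insert⁻ u ρ a∈)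

    insertionSum-∈-insert : ∀ {q} a (c : Chain n (suc q)) ρ {u} → ApexFree a c → Increasing ρ →
                            u ∈ insert a ρ → insertionSum c ρ u ≈ 0#
    insertionSum-∈-insert a c ρ {u} c-free inc u∈ with u ∈? ρ
    ... | yes u∈ρ = insertionSum-∈ c ρ (λ σ ¬inc → c-free σ (inj₁ ¬inc)) u∈ρ
    ... | no u∉ρ with ∈-insert⁻ a ρ u∈
    ...   | inj₂ u∈ρ    = ⊥-elim (u∉ρ u∈ρ)
    ...   | inj₁ refl = ≈-trans (insertionSum-∉ c ρ u (λ σ ¬inc → c-free σ (inj₁ ¬inc)) inc u∉ρ)
                                (≈-trans (*-congˡ (c-free _ (inj₂ (∈-insert u ρ)))) (zeroʳ _))

    ∂-cone-insert : ∀ {q} a (c : Chain n (suc q)) ρ → ApexFree a c → Increasing ρ → ¬ a ∈ ρ →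
                    ∂ (suc q) (cone a c) (insert a ρ) ≈ c (insert a ρ) - cone a (∂ q c) (insert a ρ)
    ∂-cone-insert {q} a c ρ c-free inc a∉ρ = begin
      ∂ (suc q) (cone a c) τ                  ≈⟨ ∂≈Σ-insertionSum (suc q) (cone a c) τ ⟩
      Σᶠ n (insertionSum (cone a c) τ)        ≈⟨ Σᶠ-cong n term ⟩
      Σᶠ n (λ u → - (s · insertionSum c ρ u)) ≈⟨ Σᴸ-neg (allFin n) _ ⟨
      - Σᶠ n (λ u → s · insertionSum c ρ u)   ≈⟨ -‿cong (Σᴸ-*ˡ (allFin n) s _) ⟨
      - (s · Σᶠ n (insertionSum c ρ))         ≈⟨ -‿cong (*-congˡ (∂≈Σ-insertionSum q c ρ)) ⟨
      - (s · ∂ q c ρ)                         ≈⟨ -‿cong (cone-insert a (∂ q c) ρ inc a∉ρ) ⟨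
      - cone a (∂ q c) τ                      ≈⟨ +-identityˡ _ ⟨
      0# - cone a (∂ q c) τ                   ≈⟨ +-congʳ (c-free τ (inj₂ (∈-insert a ρ))) ⟨
      c τ - cone a (∂ q c) τ                  ∎
      where
      τ = insert a ρ
      s = sgn (rank a ρ)
      term : ∀ u → insertionSum (cone a c) τ u ≈ - (s · insertionSum c ρ u)
      term u with u ∈? τ
      ... | yes u∈τ = begin
        insertionSum (cone a c) τ u      ≈⟨ insertionSum-∈ (cone a c) τ (cone-SupportedOnIncreasing a c) u∈τ ⟩
        0#                               ≈⟨ ε⁻¹≈ε ⟨
        - 0#                             ≈⟨ -‿cong (zeroʳ s) ⟨
        - (s · 0#)                       ≈⟨ -‿cong (*-congˡ (insertionSum-∈-insert a c ρ c-free inc u∈τ)) ⟨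
        - (s · insertionSum c ρ u)       ∎
      ... | no u∉τ = insertionSum-cone-insert a c ρ u (λ σ ¬inc → c-free σ (inj₁ ¬inc)) inc a∉ρ u∉τ

    ∂-cone : ∀ {q} a (c : Chain n (suc q)) → ApexFree a c → ∀ τ → ∂ (suc q) (cone a c) τ ≈ c τ - cone a (∂ q c) τ
    ∂-cone {q} a c c-free τ = cases (increasing? τ)
      where
      Goal = ∂ (suc q) (cone a c) τ ≈ c τ - cone a (∂ q c) τ
      cases : Dec (Increasing τ) → Goal
      cases (no ¬inc) = begin
        ∂ (suc q) (cone a c) τ
          ≈⟨ ∂≈Σ-insertionSum (suc q) (cone a c) τ ⟩
        Σᶠ n (insertionSum (cone a c) τ)
          ≈⟨ Σᴸ-zero (allFin n) (λ u → Σᴸ-zero (allFin _) (λ i → ≈-trans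
               (*-congˡ (cone-SupportedOnIncreasing a c _ (¬inc ∘ insertAt-Increasing⁻ τ i u))) (zeroʳ _))) ⟩
        0#
          ≈⟨ 0#-0#≈0# ⟨
        0# - 0#
          ≈⟨ +-cong (c-free τ (inj₁ ¬inc)) (-‿cong (cone-SupportedOnIncreasing a _ τ ¬inc)) ⟨
        c τ - cone a (∂ q c) τ ∎
      cases (yes inc) with a ∈? τ
      ... | no a∉τ = ≈-trans (∂-cone-∉ a c τ inc a∉τ)
                           (≈-sym (≈-trans (+-congˡ (-‿cong (cone-∉ a (∂ q c) τ a∉τ))) (x-0#≈x _)))
      ... | yes a∈τ with Increasing-∈⇒insert τ inc a∈τ
      ...   | ρ , incρ , a∉ρ , refl = ∂-cone-insert a c ρ c-free incρ a∉ρ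

  -- The cross-polytope cycle of an induced matching

  module _ {n : ℕ} (G : Graph n) (loopless : ∀ v → G v v ≡ false) where

    private
      true≢false : true ≢ false
      true≢false ()

    IsEnd : ∀ {d} → (Fin d → Fin 2 → Fin n) → Fin n → Set
    IsEnd end v = ∃₂ λ i s → v ≡ end i s

    SpannedFace : ∀ {d p} → (Fin d → Fin 2 → Fin n) → Vec (Fin n) p → Set
    SpannedFace end σ = IsFace G σ × (∀ j → IsEnd end (lookup σ j))

    module _ {d} {end : Fin d → Fin 2 → Fin n} (M : InducedMatching G end) where

      open InducedMatching M

      ends-distinct : ∀ {i j} → i ≢ j → ∀ s t → end i s ≢ end j t
      ends-distinct {j = j} i≢j s 0F e = true≢false (trans (sym (edge _)) (trans (cong (λ v → G v (end j 1F)) (sym e)) (apart i≢j s 1F)))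
      ends-distinct i≢j s 1F e = true≢false (trans (sym (edge _)) (trans (cong (G _) (sym e)) (apart (i≢j ∘ sym) 0F s)))

      matched-ends-distinct : ∀ i → end i 0F ≢ end i 1F
      matched-ends-distinct i e = true≢false (trans (sym (edge i)) (trans (cong (G _) (sym e)) (loopless _)))

    InducedMatching-tail : ∀ {d} {end : Fin (suc d) → Fin 2 → Fin n} →
                           InducedMatching G end → InducedMatching G (end ∘ suc)
    InducedMatching-tail M = record
      { edge  = edge ∘ suc
      ; apart = λ i≢j → apart (i≢j ∘ suc-injective)
      }
      where open InducedMatching M

    -- the join of the d zero-spheres {end i 0F, end i 1F}
    crossPolytope : ∀ d → (Fin d → Fin 2 → Fin n) → Chain n d
    crossPolytope zero    end [] = 1#
    crossPolytope (suc d) end σ  = cone (end 0F 0F) (crossPolytope d (end ∘ suc)) σ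
                                 - cone (end 0F 1F) (crossPolytope d (end ∘ suc)) σ

    SpannedFace-removeAt : ∀ {d} {end : Fin (suc d) → Fin 2 → Fin n} → InducedMatching G end →
      ∀ {p} {σ : Vec (Fin n) (suc p)} {k s} → Increasing σ → lookup σ k ≡ end 0F s →
      SpannedFace (end ∘ suc) (removeAt σ k) → SpannedFace end σ
    SpannedFace-removeAt {end = end} M {σ = σ} {k} {s} inc σₖ≡a ((_ , independent′) , ends′) =
      (inc , independent) , ends
      where
      open InducedMatching M
      ends : ∀ j → IsEnd end (lookup σ j)
      ends j with lookup-removeAt⁻ σ k j
      ... | inj₁ refl     = 0F , s , σₖ≡a
      ... | inj₂ (j′ , e) with ends′ j′
      ...   | l , t , e′ = suc l , t , trans e e′
      independent : Independent G σ
      independent i j with lookup-removeAt⁻ σ k i | lookup-removeAt⁻ σ k j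
      ... | inj₁ refl | inj₁ refl = trans (cong (λ v → G v v) σₖ≡a) (loopless _)
      ... | inj₁ refl | inj₂ (j′ , e) with ends′ j′
      ...   | l , t , e′ = trans (cong₂ G σₖ≡a (trans e e′)) (apart (λ ()) s t)
      independent i j | inj₂ (i′ , e) | inj₁ refl with ends′ i′
      ...   | l , t , e′ = trans (cong₂ G (trans e e′) σₖ≡a) (apart (λ ()) t s)
      independent i j | inj₂ (i′ , e) | inj₂ (j′ , e₂) = trans (cong₂ G e e₂) (independent′ i′ j′)

    crossPolytope-support : ∀ d {end : Fin d → Fin 2 → Fin n} → InducedMatching G end →
                            ∀ σ → ¬ SpannedFace end σ → crossPolytope d end σ ≈ 0#
    crossPolytope-support zero    M [] ¬face = ⊥-elim (¬face ((tt , (λ ())) , (λ ())))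
    crossPolytope-support (suc d) {end} M σ ¬face =
      ≈-trans (+-cong (cone-at-end 0F) (-‿cong (cone-at-end 1F))) 0#-0#≈0#
      where
      cone-at-end : ∀ s → cone (end 0F s) (crossPolytope d (end ∘ suc)) σ ≈ 0#
      cone-at-end s with increasing? σ
      ... | no  _   = ≈-refl
      ... | yes inc = cone′-vanishes (end 0F s) _ σ (λ k σₖ≡a →
        crossPolytope-support d (InducedMatching-tail M) (removeAt σ k) (¬face ∘ SpannedFace-removeAt M inc σₖ≡a))

    crossPolytope-ApexFree : ∀ d {end : Fin (suc d) → Fin 2 → Fin n} → InducedMatching G end →
                             ∀ s → ApexFree (end 0F s) (crossPolytope d (end ∘ suc))
    crossPolytope-ApexFree d M s σ apex∈ =
      crossPolytope-support d (InducedMatching-tail M) σ (¬spanned apex∈)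
      where
      ¬spanned : ¬ Increasing σ ⊎ _ ∈ σ → ¬ SpannedFace _ σ
      ¬spanned (inj₁ ¬inc)  ((inc , _) , _) = ¬inc inc
      ¬spanned (inj₂ (j , e)) (_ , ends) with ends j
      ... | l , t , e′ = ends-distinct M (λ ()) s t (trans (sym e) e′)

    crossPolytope-cycle : ∀ d {end : Fin (suc d) → Fin 2 → Fin n} → InducedMatching G end →
                          ∀ τ → ∂ d (crossPolytope (suc d) end) τ ≈ 0#
    crossPolytope-cycle zero {end} M [] = begin
      ∂ 0 (λ σ → cone x Z σ - cone y Z σ) []  ≈⟨ ∂-sub 0 (cone x Z) (cone y Z) [] ⟩
      ∂ 0 (cone x Z) [] - ∂ 0 (cone y Z) []   ≈⟨ +-cong (∂-cone-∉ x Z [] tt (λ ())) (-‿cong (∂-cone-∉ y Z [] tt (λ ()))) ⟩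
      Z [] - Z []                             ≈⟨ -‿inverseʳ _ ⟩
      0#                                      ∎
      where
      x = end 0F 0F
      y = end 0F 1F
      Z = crossPolytope 0 (end ∘ suc)
    crossPolytope-cycle (suc d) {end} M τ = begin
      ∂ (suc d) (λ σ → cone x Z σ - cone y Z σ) τ
        ≈⟨ ∂-sub (suc d) (cone x Z) (cone y Z) τ ⟩
      ∂ (suc d) (cone x Z) τ - ∂ (suc d) (cone y Z) τ
        ≈⟨ +-cong (∂-cone x Z (crossPolytope-ApexFree (suc d) M 0F) τ)
                  (-‿cong (∂-cone y Z (crossPolytope-ApexFree (suc d) M 1F) τ)) ⟩
      (Z τ - cone x (∂ d Z) τ) - (Z τ - cone y (∂ d Z) τ)
        ≈⟨ +-cong (+-congˡ (-‿cong (cone-zero x _ τ ∂Z≈0))) (-‿cong (+-congˡ (-‿cong (cone-zero y _ τ ∂Z≈0)))) ⟩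
      (Z τ - 0#) - (Z τ - 0#)
        ≈⟨ -‿inverseʳ _ ⟩
      0# ∎
      where
      x = end 0F 0F
      y = end 0F 1F
      Z = crossPolytope (suc d) (end ∘ suc)
      ∂Z≈0 : ∀ σ → ∂ d Z σ ≈ 0#
      ∂Z≈0 = crossPolytope-cycle d (InducedMatching-tail M)

    firstEnds : ∀ d → (Fin d → Fin 2 → Fin n) → Vec (Fin n) d
    firstEnds zero    end = []
    firstEnds (suc d) end = insert (end 0F 0F) (firstEnds d (end ∘ suc))

    firstEnds-∈⁻ : ∀ d {end : Fin d → Fin 2 → Fin n} {v} → v ∈ firstEnds d end → ∃ λ i → v ≡ end i 0F
    firstEnds-∈⁻ (suc d) {end} v∈ with ∈-insert⁻ (end 0F 0F) (firstEnds d (end ∘ suc)) v∈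
    ... | inj₁ e   = 0F , e
    ... | inj₂ v∈′ with firstEnds-∈⁻ d v∈′
    ...   | i , e = suc i , e

    firstEnds-∈ : ∀ d (end : Fin d → Fin 2 → Fin n) i → end i 0F ∈ firstEnds d end
    firstEnds-∈ (suc d) end zero    = ∈-insert (end 0F 0F) (firstEnds d (end ∘ suc))
    firstEnds-∈ (suc d) end (suc i) = ∈-insert⁺ (end 0F 0F) (firstEnds d (end ∘ suc)) (firstEnds-∈ d (end ∘ suc) i)

    head∉firstEnds-tail : ∀ d {end : Fin (suc d) → Fin 2 → Fin n} → InducedMatching G end →
                          ∀ s → ¬ end 0F s ∈ firstEnds d (end ∘ suc)
    head∉firstEnds-tail d M s a∈ with firstEnds-∈⁻ d a∈
    ... | i , e = ends-distinct M (λ ()) s 0F e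

    firstEnds-Increasing : ∀ d {end : Fin d → Fin 2 → Fin n} → InducedMatching G end → Increasing (firstEnds d end)
    firstEnds-Increasing zero    M = tt
    firstEnds-Increasing (suc d) M = insert-Increasing _ _
      (firstEnds-Increasing d (InducedMatching-tail M)) (head∉firstEnds-tail d M 0F)

    crossPolytope-firstEnds : ∀ d {end : Fin d → Fin 2 → Fin n} → InducedMatching G end →
                              IsSign (crossPolytope d end (firstEnds d end))
    crossPolytope-firstEnds zero    M = inj₁ ≈-refl
    crossPolytope-firstEnds (suc d) {end} M = IsSign-resp-≈ (≈-sym value)
      (IsSign-· (IsSign-sgn (rank x σ)) (crossPolytope-firstEnds d (InducedMatching-tail M)))
      where
      x = end 0F 0F
      y = end 0F 1F
      σ = firstEnds d (end ∘ suc)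
      Z = crossPolytope d (end ∘ suc)
      y∉ : ¬ y ∈ insert x σ
      y∉ y∈ = [ (λ y≡x → matched-ends-distinct M 0F (sym y≡x)) , head∉firstEnds-tail d M 1F ]′ (∈-insert⁻ x σ y∈)
      value : cone x Z (insert x σ) - cone y Z (insert x σ) ≈ sgn (rank x σ) · Z σ
      value = begin
        cone x Z (insert x σ) - cone y Z (insert x σ)
          ≈⟨ +-cong (cone-insert x Z σ (firstEnds-Increasing d (InducedMatching-tail M)) (head∉firstEnds-tail d M 0F))
                    (-‿cong (cone-∉ y Z _ y∉)) ⟩
        sgn (rank x σ) · Z σ - 0#
          ≈⟨ x-0#≈x _ ⟩
        sgn (rank x σ) · Z σ ∎

    firstEnds-maximal : ∀ d {end : Fin d → Fin 2 → Fin n} → Dominates G (λ i → end i 0F) →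
                        ∀ i u → ¬ IsFace G (insertAt (firstEnds d end) i u)
    firstEnds-maximal d {end} dominating i u (inc , independent) with dominating u
    ... | inj₁ (j , refl) = ∈⇒insertAt-¬Increasing σ i (firstEnds-∈ d end j) inc
      where σ = firstEnds d end
    ... | inj₂ (j , adjacent) with firstEnds-∈ d end j
    ...   | k , σₖ≡x = true≢false (trans (sym adjacent) (trans (cong₂ G x≡ u≡) (independent (punchIn i k) i)))
      where
      σ = firstEnds d end
      x≡ : end j 0F ≡ lookup (insertAt σ i u) (punchIn i k)
      x≡ = trans (sym σₖ≡x) (sym (insertAt-punchIn σ i u k))
      u≡ : u ≡ lookup (insertAt σ i u) i
      u≡ = sym (insertAt-lookup σ i u)

    DominatingInducedMatching⇒NonzeroReducedHomology : ∀ {d} → DominatingInducedMatching G (suc d) →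
                                                       NonzeroReducedHomology G d
    DominatingInducedMatching⇒NonzeroReducedHomology {d} M =
      Z , Z-chain , crossPolytope-cycle d matching , ¬boundary
      where
      open DominatingInducedMatching M
      Z = crossPolytope (suc d) end
      σ = firstEnds (suc d) end
      Z-chain : IsChain G Z
      Z-chain τ ¬face = crossPolytope-support (suc d) matching τ (¬face ∘ proj₁)
      ¬boundary : ¬ (∃ λ b → IsChain G b × (∀ τ → ∂ (suc d) b τ ≈ Z τ))
      ¬boundary (b , b-chain , ∂b≈Z) = IsSign⇒≉0# (crossPolytope-firstEnds (suc d) matching)
        (≈-trans (≈-sym (∂b≈Z σ)) (∂-vanishes-at-maximalFace G b σ b-chain (firstEnds-maximal (suc d) {end} dominating)))

mainTheorem10 : ∀ {c ℓ : Level} (F : Field c ℓ) (d n : ℕ) → 2 * suc d ≤ n →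
    (H : Graph n) → IsSimple H → InB d n H →
    Homology.NonzeroReducedHomology F H d
-- The bound 2(d+1) ≤ n is implied by H ∈ B_{n,d}.
mainTheorem10 F d n _ H (_ , loopless) H∈B =
  Chains.DominatingInducedMatching⇒NonzeroReducedHomology F H loopless (InB⇒DominatingInducedMatching H∈B)
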